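{- For $n\in\mathbb{N}$ let $\mathcal{K}_n=\{E\in\mathcal{N} : \max E=n,\ \min E>\omega_{2,3}(E),\ \text{and } |E|\neq2\}$. Then $|\mathcal{K}_{n+1}|=F_n$ for all $n\in\mathbb{N}$.
   Context: $\mathbb{N}=\{1,2,3,\dots\}$, and $\mathcal{N}$ denotes the collection of finite (nonempty where $\max,\min$ are used) subsets of $\mathbb{N}$. For $E\in\mathcal{N}$, $\omega_{2,3}(E)=\sum_{i\in E\setminus\{2,3\}}1=|E\setminus\{2,3\}|$. $(F_n)_{n\ge0}$ is the Fibonacci sequence: $F_0=0$, $F_1=1$, $F_n=F_{n-1}+F_{n-2}$ for $n\ge2$. -}

module Defs where

open import Data.Nat using (ℕ; zero; suc; _+_; _<_; _⊓_; _⊔_)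
open import Data.Nat.Properties using (_≟_; _<?_)
open import Data.List using (List; []; _∷_; _++_; map; length; filter; foldr; _∷ʳ_)
open import Data.Product using (_×_)
open import Data.Sum using (_⊎_)
open import Relation.Nullary using (¬_; Dec)
open import Relation.Nullary.Decidable using (_×-dec_; _⊎-dec_; ¬?)
open import Relation.Binary.PropositionalEquality using (_≡_; _≢_)

F : ℕ → ℕ
F zero = zero
F (suc zero) = suc zero
F (suc (suc n)) = F (suc n) + F n

-- A finite set E ⊆ ℕ is represented by the (strictly increasing) list of its elements.
-- subsetsUpTo n enumerates every subset of {1,…,n} exactly once.
subsetsUpTo : ℕ → List (List ℕ)
subsetsUpTo zero = [] ∷ []
subsetsUpTo (suc n) = subsetsUpTo n ++ map (λ E → E ∷ʳ suc n) (subsetsUpTo n)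

-- max and min of a (nonempty) finite set; on the empty list they return 0
maxE : List ℕ → ℕ
maxE [] = 0
maxE (x ∷ xs) = foldr _⊔_ x xs

minE : List ℕ → ℕ
minE [] = 0
minE (x ∷ xs) = foldr _⊓_ x xs

ω₂₃ : List ℕ → ℕ
ω₂₃ E = length (filter (λ x → ¬? ((x ≟ 2) ⊎-dec (x ≟ 3))) E)

-- membership condition of 𝒦_n (E nonempty, since max E = n ≥ 1 and max [] = 0)
InK : ℕ → List ℕ → Set
InK n E = (maxE E ≡ n) × (ω₂₃ E < minE E) × (length E ≢ 2)

InK? : (n : ℕ) → (E : List ℕ) → Dec (InK n E)
InK? n E = (maxE E ≟ n) ×-dec (ω₂₃ E <? minE E) ×-dec ¬? (length E ≟ 2)

-- |𝒦_n|: every E with max E = n is a subset of {1,…,n}, so it suffices to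
-- count among the subsets of {1,…,n}.
cardK : ℕ → ℕ
cardK n = length (filter (InK? n) (subsetsUpTo n))

module Submission where

-- A set in 𝒦_{n+1} is E ∪ {n+1} with E ⊆ {1,…,n}; for n ≥ 3 the new element lies outside {2,3}, so
-- the conditions become min E > ω₂₃(E) + 1 and |E| ≠ 1 (or E = ∅).  Let A(m, c) count the nonempty
-- E ⊆ {1,…,m} with min E > c + ω₂₃(E).  Splitting off the element m+1 ≥ 4 (which raises ω₂₃ by one and
-- leaves min E unchanged) gives A(m+1, c) = A(m, c) + [c < m] + A(m, c+1).  Hence A(c+j, c) + 1 = F(j+1)
-- for c ≥ 3, then A(n, 2) = F(n−1) and A(n, 1) = F n + n − 2; removing the n − 1 admissible singletons
-- and adding E = ∅ leaves exactly F n sets.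

open import Defs
open import Data.Bool using (Bool; true; false; _∧_; not; if_then_else_)
open import Data.Bool.Properties using (∧-zeroʳ)
open import Data.Empty using (⊥)
open import Data.List using (List; []; _∷_; _++_; [_]; map; length; filter; foldr; _∷ʳ_)
open import Data.List.Properties using (foldr-∷ʳ; foldr-preservesᵇ; foldr-preservesʳ; length-++; filter-++)
open import Data.List.Relation.Unary.All as All using (All; []; _∷_)
open import Data.List.Relation.Unary.All.Properties using (++⁺; ∷ʳ⁺; map⁺)
open import Data.Nat using (ℕ; zero; suc; _+_; _≤_; _<_; _⊓_; _⊔_; z≤n; s≤s)
open import Data.Nat.Properties
open import Data.Nat.Tactic.RingSolver using (solve-∀)
open import Data.Product using (_,_)
open import Relation.Nullary using (does)
open import Relation.Nullary.Decidable using (dec-true; dec-false)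
open import Relation.Unary using (Decidable)
open import Relation.Binary.PropositionalEquality using (_≡_; refl; sym; trans; cong; cong₂; subst; module ≡-Reasoning)

count : {A : Set} → (A → Bool) → List A → ℕ
count p []       = 0
count p (x ∷ xs) = if p x then suc (count p xs) else count p xs

length-filter≡count : {A : Set} {P : A → Set} (P? : Decidable P) (xs : List A) →
                      length (filter P? xs) ≡ count (λ x → does (P? x)) xs
length-filter≡count P? []       = refl
length-filter≡count P? (x ∷ xs) with does (P? x)
... | true  = cong suc (length-filter≡count P? xs)
... | false = length-filter≡count P? xs

count-++ : {A : Set} (p : A → Bool) (xs ys : List A) → count p (xs ++ ys) ≡ count p xs + count p ys
count-++ p []       ys = refl
count-++ p (x ∷ xs) ys with p x
... | true  = cong suc (count-++ p xs ys)
... | false = count-++ p xs ys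

count-map : {A B : Set} (p : B → Bool) (f : A → B) (xs : List A) →
            count p (map f xs) ≡ count (λ x → p (f x)) xs
count-map p f []       = refl
count-map p f (x ∷ xs) with p (f x)
... | true  = cong suc (count-map p f xs)
... | false = count-map p f xs

count-cong : {A : Set} {P : A → Set} {p q : A → Bool} {xs : List A} →
             (∀ {x} → P x → p x ≡ q x) → All P xs → count p xs ≡ count q xs
count-cong p≡q []         = refl
count-cong p≡q (px ∷ pxs) = cong₂ (λ b n → if b then suc n else n) (p≡q px) (count-cong p≡q pxs)

count-false : {A : Set} {P : A → Set} {p : A → Bool} {xs : List A} →
              (∀ {x} → P x → p x ≡ false) → All P xs → count p xs ≡ 0
count-false p≡false []         = refl
count-false p≡false (px ∷ pxs) rewrite p≡false px = count-false p≡false pxs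

count-∧-not+count-∧ : {A : Set} (p q : A → Bool) (xs : List A) →
                      count (λ x → p x ∧ not (q x)) xs + count (λ x → p x ∧ q x) xs ≡ count p xs
count-∧-not+count-∧ p q [] = refl
count-∧-not+count-∧ p q (x ∷ xs) with p x | q x
... | true  | true  = trans (+-suc _ _) (cong suc (count-∧-not+count-∧ p q xs))
... | true  | false = cong suc (count-∧-not+count-∧ p q xs)
... | false | _     = count-∧-not+count-∧ p q xs

nonemptySubsetsUpTo : ℕ → List (List ℕ)
nonemptySubsetsUpTo zero    = []
nonemptySubsetsUpTo (suc k) = nonemptySubsetsUpTo k ++ map (_∷ʳ suc k) ([] ∷ nonemptySubsetsUpTo k)

subsetsUpTo≡[]∷nonemptySubsetsUpTo : ∀ k → subsetsUpTo k ≡ [] ∷ nonemptySubsetsUpTo k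
subsetsUpTo≡[]∷nonemptySubsetsUpTo zero    = refl
subsetsUpTo≡[]∷nonemptySubsetsUpTo (suc k) rewrite subsetsUpTo≡[]∷nonemptySubsetsUpTo k = refl

count-nonemptySubsetsUpTo-suc : (p : List ℕ → Bool) (k : ℕ) →
  count p (nonemptySubsetsUpTo (suc k)) ≡
  count p (nonemptySubsetsUpTo k) + count (λ E → p (E ∷ʳ suc k)) ([] ∷ nonemptySubsetsUpTo k)
count-nonemptySubsetsUpTo-suc p k =
  trans (count-++ p (nonemptySubsetsUpTo k) _)
        (cong (count p (nonemptySubsetsUpTo k) +_) (count-map p (_∷ʳ suc k) ([] ∷ nonemptySubsetsUpTo k)))

NonemptyBoundedBy : ℕ → List ℕ → Set
NonemptyBoundedBy k []       = ⊥
NonemptyBoundedBy k (x ∷ xs) = All (_≤ k) (x ∷ xs)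

NonemptyBoundedBy-suc : ∀ {k E} → NonemptyBoundedBy k E → NonemptyBoundedBy (suc k) E
NonemptyBoundedBy-suc {E = _ ∷ _} E≤k = All.map m≤n⇒m≤1+n E≤k

NonemptyBoundedBy-∷ʳ : ∀ {k E} → All (_≤ k) E → NonemptyBoundedBy (suc k) (E ∷ʳ suc k)
NonemptyBoundedBy-∷ʳ {E = []}    []    = ≤-refl ∷ []
NonemptyBoundedBy-∷ʳ {E = _ ∷ _} E≤k  = ∷ʳ⁺ (All.map m≤n⇒m≤1+n E≤k) ≤-refl

nonemptySubsetsUpTo-bounded : ∀ k → All (NonemptyBoundedBy k) (nonemptySubsetsUpTo k)
nonemptySubsetsUpTo-bounded zero    = []
nonemptySubsetsUpTo-bounded (suc k) =
  ++⁺ (All.map NonemptyBoundedBy-suc bounded)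
      (map⁺ {f = _∷ʳ suc k} (All.map NonemptyBoundedBy-∷ʳ ([] ∷ All.map all≤ bounded)))
  where
  bounded = nonemptySubsetsUpTo-bounded k
  all≤ : ∀ {E} → NonemptyBoundedBy k E → All (_≤ k) E
  all≤ {_ ∷ _} E≤k = E≤k

minE-≤ : ∀ {k x} xs → x ≤ k → minE (x ∷ xs) ≤ k
minE-≤ {k} xs x≤k = foldr-preservesʳ {P = _≤ k} (λ y → m≤n⇒o⊓m≤n y) x≤k xs

maxE-≤ : ∀ {k x xs} → All (_≤ k) (x ∷ xs) → maxE (x ∷ xs) ≤ k
maxE-≤ (x≤k ∷ xs≤k) = foldr-preservesᵇ ⊔-lub x≤k xs≤k

minE-∷ʳ : ∀ {x y} xs → x ≤ y → minE ((x ∷ xs) ∷ʳ y) ≡ minE (x ∷ xs)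
minE-∷ʳ {x} {y} xs x≤y = trans (foldr-∷ʳ _⊓_ x y xs) (cong (λ z → foldr _⊓_ z xs) (m≥n⇒m⊓n≡n x≤y))

foldr-⊔-≤ : ∀ {y} xs → All (_≤ y) xs → foldr _⊔_ y xs ≡ y
foldr-⊔-≤ []       []            = refl
foldr-⊔-≤ (x ∷ xs) (x≤y ∷ xs≤y) = trans (cong (x ⊔_) (foldr-⊔-≤ xs xs≤y)) (m≤n⇒m⊔n≡n x≤y)

maxE-∷ʳ : ∀ {y} xs → All (_≤ y) xs → maxE (xs ∷ʳ y) ≡ y
maxE-∷ʳ         []       []            = refl
maxE-∷ʳ {y} (x ∷ xs) (x≤y ∷ xs≤y) =
  trans (foldr-∷ʳ _⊔_ x y xs) (trans (cong (λ z → foldr _⊔_ z xs) (m≥n⇒m⊔n≡m x≤y)) (foldr-⊔-≤ xs xs≤y))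

length-∷ʳ : {A : Set} (xs : List A) (y : A) → length (xs ∷ʳ y) ≡ suc (length xs)
length-∷ʳ []       y = refl
length-∷ʳ (x ∷ xs) y = cong suc (length-∷ʳ xs y)

ω₂₃-∷ʳ-≥4 : ∀ E {x} → 4 ≤ x → ω₂₃ (E ∷ʳ x) ≡ suc (ω₂₃ E)
ω₂₃-∷ʳ-≥4 E (s≤s (s≤s (s≤s (s≤s _)))) =
  trans (cong length (filter-++ _ E _)) (trans (length-++ (filter _ E)) (+-comm (ω₂₃ E) 1))

-- c is added on the left so that admissible 0 is literally the ω₂₃-condition of InK.
admissible : ℕ → List ℕ → Bool
admissible c E = does (c + ω₂₃ E <? minE E)

admissibleCount : ℕ → ℕ → ℕ
admissibleCount m c = count (admissible c) (nonemptySubsetsUpTo m)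

admissible-[] : ∀ c {x} → 4 ≤ x → admissible c [ x ] ≡ does (suc c <? x)
admissible-[] c {x} 4≤x = cong (λ w → does (w <? x)) (trans (cong (c +_) (ω₂₃-∷ʳ-≥4 [] 4≤x)) (+-comm c 1))

admissible-∷ʳ : ∀ c {k E} → 3 ≤ k → NonemptyBoundedBy k E → admissible c (E ∷ʳ suc k) ≡ admissible (suc c) E
admissible-∷ʳ c {k} {x ∷ xs} 3≤k (x≤k ∷ _) = cong₂ (λ a b → does (a <? b)) ω-shift (minE-∷ʳ xs (m≤n⇒m≤1+n x≤k))
  where
  ω-shift : c + ω₂₃ ((x ∷ xs) ∷ʳ suc k) ≡ suc c + ω₂₃ (x ∷ xs)
  ω-shift = trans (cong (c +_) (ω₂₃-∷ʳ-≥4 (x ∷ xs) (s≤s 3≤k))) (+-suc c _)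

admissibleCount-vanish : ∀ {m c} → m ≤ c → admissibleCount m c ≡ 0
admissibleCount-vanish {m} {c} m≤c = count-false not-admissible (nonemptySubsetsUpTo-bounded m)
  where
  not-admissible : ∀ {E} → NonemptyBoundedBy m E → admissible c E ≡ false
  not-admissible {x ∷ xs} (x≤m ∷ _) =
    dec-false (_ <? _) (λ lt → <⇒≱ lt (≤-trans (minE-≤ xs x≤m) (≤-trans m≤c (m≤m+n c _))))

count-admissible-∷ʳ : ∀ c {m} → 3 ≤ m →
  count (λ E → admissible c (E ∷ʳ suc m)) ([] ∷ nonemptySubsetsUpTo m) ≡
  (if does (suc c <? suc m) then suc (admissibleCount m (suc c)) else admissibleCount m (suc c))
count-admissible-∷ʳ c {m} 3≤m =
  cong₂ (λ b n → if b then suc n else n)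
        (admissible-[] c (s≤s 3≤m))
        (count-cong (admissible-∷ʳ c 3≤m) (nonemptySubsetsUpTo-bounded m))

admissibleCount-suc-< : ∀ {m c} → 3 ≤ m → c < m →
                        admissibleCount (suc m) c ≡ admissibleCount m c + suc (admissibleCount m (suc c))
admissibleCount-suc-< {m} {c} 3≤m c<m =
  trans (count-nonemptySubsetsUpTo-suc (admissible c) m)
        (cong (admissibleCount m c +_)
              (trans (count-admissible-∷ʳ c 3≤m)
                     (cong (λ b → if b then suc shifted else shifted) (dec-true (suc c <? suc m) (s≤s c<m)))))
  where shifted = admissibleCount m (suc c)

admissibleCount-suc-≥ : ∀ {m c} → 3 ≤ m → m ≤ c → admissibleCount (suc m) c ≡ 0
admissibleCount-suc-≥ {m} {c} 3≤m m≤c =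
  trans (count-nonemptySubsetsUpTo-suc (admissible c) m)
        (cong₂ _+_ (admissibleCount-vanish m≤c)
                   (trans (count-admissible-∷ʳ c 3≤m)
                          (trans (cong (λ b → if b then suc shifted else shifted) (dec-false (suc c <? suc m) (≤⇒≯ (s≤s m≤c))))
                                 (admissibleCount-vanish (m≤n⇒m≤1+n m≤c)))))
  where shifted = admissibleCount m (suc c)

admissibleCount-fib : ∀ {c} → 3 ≤ c → ∀ j → suc (admissibleCount (c + j) c) ≡ F (suc j)
admissibleCount-fib {c} 3≤c zero =
  trans (cong (λ m → suc (admissibleCount m c)) (+-identityʳ c)) (cong suc (admissibleCount-vanish {c} ≤-refl))
admissibleCount-fib {c} 3≤c (suc zero) =
  trans (cong (λ m → suc (admissibleCount m c)) (+-comm c 1)) (cong suc (admissibleCount-suc-≥ 3≤c ≤-refl))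
admissibleCount-fib {c} 3≤c (suc (suc j)) = begin
  suc (admissibleCount (c + suc (suc j)) c)         ≡⟨ cong (λ n → suc (admissibleCount n c)) (+-suc c (suc j)) ⟩
  suc (admissibleCount (suc m) c)                   ≡⟨ cong suc (admissibleCount-suc-< (≤-trans 3≤c (m≤m+n c _)) (m<m+n c (s≤s z≤n))) ⟩
  suc (admissibleCount m c) + suc (admissibleCount m (suc c))
    ≡⟨ cong₂ _+_ (admissibleCount-fib 3≤c (suc j))
                 (trans (cong (λ n → suc (admissibleCount n (suc c))) (+-suc c j)) (admissibleCount-fib (m≤n⇒m≤1+n 3≤c) j)) ⟩
  F (suc (suc j)) + F (suc j)                       ∎
  where
  open ≡-Reasoning
  m = c + suc j

admissibleCount-2 : ∀ j → admissibleCount (3 + j) 2 ≡ F (2 + j)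
admissibleCount-2 zero    = refl
admissibleCount-2 (suc j) =
  trans (admissibleCount-suc-< (m≤m+n 3 j) (s≤s (s≤s (s≤s z≤n))))
        (cong₂ _+_ (admissibleCount-2 j) (admissibleCount-fib ≤-refl j))

admissibleCount-1 : ∀ j → admissibleCount (3 + j) 1 ≡ F (3 + j) + suc j
admissibleCount-1 zero    = refl
admissibleCount-1 (suc j) =
  trans (admissibleCount-suc-< (m≤m+n 3 j) (s≤s (s≤s z≤n)))
        (trans (cong₂ (λ a b → a + suc b) (admissibleCount-1 j) (admissibleCount-2 j))
               (rearrange (F (3 + j)) (F (2 + j)) (suc j)))
  where
  rearrange : ∀ a b s → a + s + suc b ≡ a + b + suc s
  rearrange = solve-∀

isSingleton : List ℕ → Bool
isSingleton E = does (length E ≟ 1)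

isSingleton-∷ʳ : ∀ y ys x → isSingleton ((y ∷ ys) ∷ʳ x) ≡ false
isSingleton-∷ʳ y []      x = refl
isSingleton-∷ʳ y (_ ∷ _) x = refl

admissible-1-[] : ∀ x → admissible 1 [ suc (suc x) ] ≡ true
admissible-1-[] zero          = refl
admissible-1-[] (suc zero)    = refl
admissible-1-[] (suc (suc x)) =
  trans (admissible-[] 1 {4 + x} (s≤s (s≤s (s≤s (s≤s z≤n))))) (dec-true (2 <? 4 + x) (s≤s (s≤s (s≤s z≤n))))

admissibleSingletonCount : ∀ m → count (λ E → admissible 1 E ∧ isSingleton E) (nonemptySubsetsUpTo (suc m)) ≡ m
admissibleSingletonCount zero    = refl
admissibleSingletonCount (suc m) =
  trans (count-nonemptySubsetsUpTo-suc singleton (suc m))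
        (trans (cong₂ _+_ (admissibleSingletonCount m) new) (+-comm m 1))
  where
  singleton : List ℕ → Bool
  singleton E = admissible 1 E ∧ isSingleton E
  extended : ∀ {E} → NonemptyBoundedBy (suc m) E → singleton (E ∷ʳ suc (suc m)) ≡ false
  extended {y ∷ ys} _ = trans (cong (admissible 1 E′ ∧_) (isSingleton-∷ʳ y ys _)) (∧-zeroʳ (admissible 1 E′))
    where E′ = (y ∷ ys) ∷ʳ suc (suc m)
  new : count (λ E → singleton (E ∷ʳ suc (suc m))) ([] ∷ nonemptySubsetsUpTo (suc m)) ≡ 1
  new = cong₂ (λ b n → if b ∧ true then suc n else n)
              (admissible-1-[] m) (count-false extended (nonemptySubsetsUpTo-bounded (suc m)))

cardK-suc : ∀ {n} → 3 ≤ n →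
  cardK (suc n) ≡ suc (count (λ E → admissible 1 E ∧ not (isSingleton E)) (nonemptySubsetsUpTo n))
cardK-suc {n} 3≤n = begin
  cardK N                                                         ≡⟨ length-filter≡count (InK? N) (subsetsUpTo N) ⟩
  count inK (subsetsUpTo N)                                       ≡⟨ cong (count inK) (subsetsUpTo≡[]∷nonemptySubsetsUpTo N) ⟩
  count inK (nonemptySubsetsUpTo N)                               ≡⟨ count-nonemptySubsetsUpTo-suc inK n ⟩
  count inK (nonemptySubsetsUpTo n) + count (λ E → inK (E ∷ʳ N)) ([] ∷ nonemptySubsetsUpTo n)
    ≡⟨ cong₂ _+_ (count-false below (nonemptySubsetsUpTo-bounded n)) extensions ⟩
  suc (count (λ E → admissible 1 E ∧ not (isSingleton E)) (nonemptySubsetsUpTo n)) ∎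
  where
  open ≡-Reasoning
  N = suc n
  inK : List ℕ → Bool
  inK E = does (InK? N E)
  below : ∀ {E} → NonemptyBoundedBy n E → inK E ≡ false
  below {E@(_ ∷ _)} E≤n =
    cong (λ b → b ∧ admissible 0 E ∧ not (does (length E ≟ 2))) (dec-false (maxE E ≟ N) (<⇒≢ (s≤s (maxE-≤ E≤n))))
  extended : ∀ {E} → NonemptyBoundedBy n E → inK (E ∷ʳ N) ≡ admissible 1 E ∧ not (isSingleton E)
  extended {E@(x ∷ xs)} E≤n@(x≤n ∷ _) = begin
    inK (E ∷ʳ N)
      ≡⟨ cong₂ (λ M L → does (M ≟ N) ∧ does (ω₂₃ (E ∷ʳ N) <? minE (E ∷ʳ N)) ∧ not (does (L ≟ 2)))
               (maxE-∷ʳ E (All.map m≤n⇒m≤1+n E≤n)) (length-∷ʳ E N) ⟩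
    does (N ≟ N) ∧ does (ω₂₃ (E ∷ʳ N) <? minE (E ∷ʳ N)) ∧ not (isSingleton E)
      ≡⟨ cong₂ (λ b a → b ∧ a ∧ not (isSingleton E))
               (dec-true (N ≟ N) refl) (admissible-∷ʳ 0 3≤n E≤n) ⟩
    admissible 1 E ∧ not (isSingleton E) ∎
  [N]∈K : InK N [ N ]
  [N]∈K = refl , subst (_< N) (sym (ω₂₃-∷ʳ-≥4 [] (s≤s 3≤n))) (s≤s (≤-trans (s≤s z≤n) 3≤n)) , λ ()
  extensions : count (λ E → inK (E ∷ʳ N)) ([] ∷ nonemptySubsetsUpTo n) ≡
               suc (count (λ E → admissible 1 E ∧ not (isSingleton E)) (nonemptySubsetsUpTo n))
  extensions = cong₂ (λ b m → if b then suc m else m)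
                     (dec-true (InK? N [ N ]) [N]∈K) (count-cong extended (nonemptySubsetsUpTo-bounded n))

theorem1p5 : (n : ℕ) → 1 ≤ n → cardK (suc n) ≡ F n
theorem1p5 (suc zero)       _ = refl
theorem1p5 (suc (suc zero)) _ = refl
theorem1p5 n@(suc (suc (suc j))) _ = +-cancelʳ-≡ (suc j) _ _ (begin
  cardK (suc n) + suc j                  ≡⟨ cong (_+ suc j) (cardK-suc (m≤m+n 3 j)) ⟩
  suc (nonSingletons + suc j)            ≡⟨ sym (+-suc nonSingletons (suc j)) ⟩
  nonSingletons + suc (suc j)            ≡⟨ cong (nonSingletons +_) (sym (admissibleSingletonCount (suc (suc j)))) ⟩
  nonSingletons + singletons             ≡⟨ count-∧-not+count-∧ (admissible 1) isSingleton (nonemptySubsetsUpTo n) ⟩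
  admissibleCount n 1                    ≡⟨ admissibleCount-1 j ⟩
  F n + suc j                            ∎)
  where
  open ≡-Reasoning
  nonSingletons = count (λ E → admissible 1 E ∧ not (isSingleton E)) (nonemptySubsetsUpTo n)
  singletons    = count (λ E → admissible 1 E ∧ isSingleton E) (nonemptySubsetsUpTo n)
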